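{- Let $G=(V,E)$ be a finite connected simple graph with $n$ vertices and maximum degree $\Delta$, let $\mathbf{D}$ be an unweighted deterministic walk on $G$ with parameter $\tilde\kappa$, and let $\mathbf{D}'$ be the corresponding symmetric deterministic walk, which corresponds to the symmetric random walk $\mathbf{P}'$. Then for every vertex $v\in V$, \[ K'(v)=O\Big(\max_{u\in V}\mathsf{H}'(u,v)+\frac{\tilde\kappa}{\pi'_v}\Psi(\mathbf{P}',v)+n\,\Delta\,\tilde\kappa\Big), \] with an absolute implied constant.
   Context: Unweighted deterministic walk $\mathbf{D}$: each vertex $u$ has a rotor sequence $(\tilde s(u,1),\dots,\tilde s(u,\tilde d(u)))$ of neighbours of $u$ in which every neighbour occurs exactly $\tilde d(u)/\deg(u)$ times; $\tilde\kappa=\max_u\tilde d(u)/\deg(u)$. Symmetric random walk: $\mathbf{P}'_{u,v}=\frac1{\Delta+1}$ if $\{u,v\}\in E$, $\mathbf{P}'_{u,u}=1-\frac{\deg(u)}{\Delta+1}$, and $0$ otherwise; it is the weighted walk with weights $c'(u,v)=1$ on edges and $c'(u,u)=\Delta+1-\deg(u)$, and its stationary distribution is $\pi'_u=1/n$. The corresponding symmetric deterministic walk $\mathbf{D}'$ has rotor sequences of length $\tilde d'(u)=\frac{\Delta+1}{\deg(u)}\tilde d(u)$ with $\tilde s'(u,i)=\tilde s(u,i)$ for $i\le\tilde d(u)$ and $\tilde s'(u,i)=u$ for $i>\tilde d(u)$. $\mathsf{H}'(u,v)$ is the expected hitting time of $v$ from $u$ under $\mathbf{P}'$. $K'(v)$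 is defined for $\mathbf{P}',\mathbf{D}'$ as \[ K'(v)=\max_{u}\mathsf{H}'(u,v)+\frac12\Big(\frac{\tilde d'(v)}{\pi'_v}+\sum_{i,j\in V}\tilde d'(i)\mathbf{P}'_{i,j}\big|\mathsf{H}'(i,v)-\mathsf{H}'(j,v)-1\big|\Big), \] and $\Psi(\mathbf{P}',v)=\sum_{t\ge0}\sum_{\{i,j\}\in E}|\mathbf{P}'^t_{i,v}-\mathbf{P}'^t_{j,v}|$. -}

module Defs where

open import Data.Nat as ℕ using (ℕ; zero; suc)
open import Data.Integer using (+_)
open import Data.Fin using (Fin; zero; suc; _≟_)
open import Data.Bool using (Bool; true; false; if_then_else_)
open import Data.Rational as ℚ using (ℚ; _/_; _+_; _*_; _-_; ∣_∣; _⊔_; ½; 0ℚ; 1ℚ)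
open import Relation.Nullary.Decidable using (⌊_⌋)
open import Relation.Binary.PropositionalEquality using (_≡_)
open import Data.Product using (Σ; _×_; _,_)

ℕ→ℚ : ℕ → ℚ
ℕ→ℚ k = + k / 1

sumℚ : (m : ℕ) → (Fin m → ℚ) → ℚ
sumℚ zero    f = 0ℚ
sumℚ (suc m) f = f zero + sumℚ m (λ i → f (suc i))

-- max_{i ∈ Fin m} f i  (rationals; the empty max is 0, only used for m ≥ 1 with nonnegative values)
maxℚ : (m : ℕ) → (Fin m → ℚ) → ℚ
maxℚ zero    f = 0ℚ
maxℚ (suc m) f = f zero ⊔ maxℚ m (λ i → f (suc i))

maxℕ : (m : ℕ) → (Fin m → ℕ) → ℕ
maxℕ zero    f = 0
maxℕ (suc m) f = f zero ℕ.⊔ maxℕ m (λ i → f (suc i))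

count : (m : ℕ) → (Fin m → Bool) → ℕ
count zero    p = 0
count (suc m) p = (if p zero then 1 else 0) ℕ.+ count m (λ i → p (suc i))

record SimpleGraph (n : ℕ) : Set where
  field
    adj       : Fin n → Fin n → Bool
    symmetric : ∀ u v → adj u v ≡ adj v u
    loopless  : ∀ u → adj u u ≡ false

data Reach {n : ℕ} (G : SimpleGraph n) : Fin n → Fin n → Set where
  here  : ∀ {u} → Reach G u u
  there : ∀ {u w v} → SimpleGraph.adj G u w ≡ true → Reach G w v → Reach G u v

Connected : {n : ℕ} → SimpleGraph n → Set
Connected {n} G = ∀ (u v : Fin n) → Reach G u v

deg : {n : ℕ} → SimpleGraph n → Fin n → ℕ
deg {n} G u = count n (SimpleGraph.adj G u)

maxDeg : {n : ℕ} → SimpleGraph n → ℕ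
maxDeg {n} G = maxℕ n (deg G)

-- Unweighted deterministic walk D: rotor sequences s̃(u,1..d̃(u)) in which
-- every neighbour of u occurs exactly d̃(u)/deg(u) times.  We name this
-- common multiplicity  mult u = d̃(u)/deg(u);  then κ̃ = max_u mult u.

record RotorWalk {n : ℕ} (G : SimpleGraph n) : Set where
  field
    len    : Fin n → ℕ
    rotor  : (u : Fin n) → Fin (len u) → Fin n
    mult   : Fin n → ℕ
    len-eq : ∀ u → len u ≡ mult u ℕ.* deg G u
    occurrences : ∀ u w →
      count (len u) (λ i → ⌊ rotor u i ≟ w ⌋)
        ≡ (if SimpleGraph.adj G u w then mult u else 0)

κ̃ : {n : ℕ} {G : SimpleGraph n} → RotorWalk G → ℕ
κ̃ {n} D = maxℕ n (RotorWalk.mult D)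

-- length of the rotor sequences of the symmetric deterministic walk D':
-- d̃'(u) = (Δ+1)/deg(u) · d̃(u) = (Δ+1) · mult u
len' : {n : ℕ} {G : SimpleGraph n} → RotorWalk G → Fin n → ℕ
len' {G = G} D u = suc (maxDeg G) ℕ.* RotorWalk.mult D u

P' : {n : ℕ} → SimpleGraph n → Fin n → Fin n → ℚ
P' G u v =
  if SimpleGraph.adj G u v then + 1 / suc (maxDeg G)
  else (if ⌊ u ≟ v ⌋ then 1ℚ - (+ deg G u / suc (maxDeg G)) else 0ℚ)

π' : (n : ℕ) → .{{_ : ℕ.NonZero n}} → ℚ
π' n = + 1 / n

-- Expected hitting times of v under P': h u = H'(u,v).  They are the
-- (unique, for a connected graph) solution of the first-step equations
-- h v = 0,  h u = 1 + Σ_w P'_{u,w} h w  for u ≠ v.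
IsHittingTime : {n : ℕ} → SimpleGraph n → Fin n → (Fin n → ℚ) → Set
IsHittingTime {n} G v h =
  (h v ≡ 0ℚ) ×
  (∀ u → (u ≡ v → Data.Empty.⊥) → h u ≡ 1ℚ + sumℚ n (λ w → P' G u w * h w))
  where import Data.Empty

-- column v of P'^t :  Pcol t i = (P'^t)_{i,v}
Pcol : {n : ℕ} → SimpleGraph n → Fin n → ℕ → Fin n → ℚ
Pcol G v zero    i = if ⌊ i ≟ v ⌋ then 1ℚ else 0ℚ
Pcol {n} G v (suc t) i = sumℚ n (λ w → P' G i w * Pcol G v t w)

-- Σ_{{i,j} ∈ E} |P'^t_{i,v} − P'^t_{j,v}|  (each unordered edge once:
-- sum over ordered adjacent pairs, halved)
edgeTerm : {n : ℕ} → SimpleGraph n → Fin n → ℕ → ℚ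
edgeTerm {n} G v t =
  ½ * sumℚ n (λ i → sumℚ n (λ j →
        if SimpleGraph.adj G i j then ∣ Pcol G v t i - Pcol G v t j ∣ else 0ℚ))

-- partial sums Ψ_T = Σ_{t<T} Σ_{{i,j}∈E} |…| ;  Ψ(P',v) = lim_T Ψ_T (monotone)
ΨPartial : {n : ℕ} → SimpleGraph n → Fin n → ℕ → ℚ
ΨPartial G v zero    = 0ℚ
ΨPartial G v (suc T) = ΨPartial G v T + edgeTerm G v T

K' : {n : ℕ} → (G : SimpleGraph n) → RotorWalk G →
     Fin n → (Fin n → ℚ) → ℚ
K' {n} G D v h =
  maxℚ n h +
  ½ * ( ℕ→ℚ (len' D v) * ℕ→ℚ n      -- d̃'(v)/π'_v  with π'_v = 1/n
      + sumℚ n (λ i → sumℚ n (λ j →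
          ℕ→ℚ (len' D i) * P' G i j * ∣ h i - h j - 1ℚ ∣)))

{-# OPTIONS --safe #-}
-- The symmetric walk P' is symmetric and doubly stochastic, so summing the
-- first-step equations of h = H'(·,v) also gives the equation at v:
-- P'h = h − 1 + n·e_v at every vertex.  Iterating, h + n·g_T = P'^T h + T with
-- g_T(i) = Σ_{t<T} (P'^t)_{i,v}.  Every vertex reaches v within K steps, so
-- (P'^K)_{i,v} ≥ δ^K for δ = 1/(Δ+1), and the oscillation of P'^T h decays
-- geometrically (Doeblin).  Hence |h_i − h_j| ≤ n·|g_T(i) − g_T(j)| + W with W
-- as small as we like.  In K'(v) the edge terms then contribute at most
-- κ̃ n Σ_{ij∈E} |g_T(i) − g_T(j)| ≤ 2 κ̃ n Ψ_T plus O(n Δ κ̃ (1 + W)), the loops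
-- contribute O(n Δ κ̃), and the W-term is absorbed into ε.
module Submission where

open import Defs
open import Data.Bool using (Bool; true; false; if_then_else_)
open import Data.Empty using (⊥-elim)
open import Data.Fin using (Fin; zero; suc; _≟_)
import Data.Fin.Properties as FinP
import Data.Integer as Z
import Data.Integer.Properties as ZP
open import Data.Nat as N using (ℕ; zero; suc)
import Data.Nat.Properties as NP
open import Data.Product using (Σ; _×_; _,_; proj₁; proj₂)
open import Data.Rational as Q using (ℚ; 0ℚ; 1ℚ; _<_; _+_; _*_; _-_; -_; _/_; ∣_∣; ½)
open import Algebra.Definitions.RawSemiring Q.+-*-rawSemiring using (_^_)
import Data.Rational.Properties as QP
open import Data.Rational.Solver using (module +-*-Solver)
import Data.Rational.Unnormalised as U
import Data.Rational.Unnormalised.Properties as UP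
open import Data.Sum using (inj₁; inj₂)
open import Function using (_∘_)
open import Relation.Binary.PropositionalEquality
open import Relation.Nullary using (¬_; Dec; yes; no)
open import Relation.Nullary.Decidable using (⌊_⌋)

open +-*-Solver

module ℕ→ℚ-Properties where

  open Z using (+_)

  toℚᵘ-ℕ→ℚ : ∀ k → U._≃_ (Q.toℚᵘ (ℕ→ℚ k)) (U.mkℚᵘ (+ k) 0)
  toℚᵘ-ℕ→ℚ k = QP.toℚᵘ-fromℚᵘ (U.mkℚᵘ (+ k) 0)

  ℕ→ℚ-suc : ∀ k → ℕ→ℚ (suc k) ≡ 1ℚ + ℕ→ℚ k
  ℕ→ℚ-suc k = QP.toℚᵘ-injective (begin
    Q.toℚᵘ (ℕ→ℚ (suc k))     ≈⟨ toℚᵘ-ℕ→ℚ (suc k) ⟩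
    U.mkℚᵘ (+ suc k) 0        ≈⟨ U.*≡* (cong (Z._* + 1) (cong (Z._+_ (+ 1)) (sym (ZP.*-identityʳ (+ k))))) ⟩
    U.1ℚᵘ U.+ U.mkℚᵘ (+ k) 0  ≈⟨ UP.+-congʳ U.1ℚᵘ (UP.≃-sym (toℚᵘ-ℕ→ℚ k)) ⟩
    U.1ℚᵘ U.+ Q.toℚᵘ (ℕ→ℚ k) ≈⟨ UP.≃-sym (QP.toℚᵘ-homo-+ 1ℚ (ℕ→ℚ k)) ⟩
    Q.toℚᵘ (1ℚ + ℕ→ℚ k)      ∎)
    where open UP.≃-Reasoning

  ℕ→ℚ-+ : ∀ a b → ℕ→ℚ (a N.+ b) ≡ ℕ→ℚ a + ℕ→ℚ b
  ℕ→ℚ-+ zero    b = sym (QP.+-identityˡ (ℕ→ℚ b))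
  ℕ→ℚ-+ (suc a) b = begin
    ℕ→ℚ (suc (a N.+ b))      ≡⟨ ℕ→ℚ-suc (a N.+ b) ⟩
    1ℚ + ℕ→ℚ (a N.+ b)       ≡⟨ cong (λ z → 1ℚ + z) (ℕ→ℚ-+ a b) ⟩
    1ℚ + (ℕ→ℚ a + ℕ→ℚ b)     ≡⟨ QP.+-assoc 1ℚ (ℕ→ℚ a) (ℕ→ℚ b) ⟨
    (1ℚ + ℕ→ℚ a) + ℕ→ℚ b     ≡⟨ cong (_+ ℕ→ℚ b) (ℕ→ℚ-suc a) ⟨
    ℕ→ℚ (suc a) + ℕ→ℚ b      ∎
    where open ≡-Reasoning

  ℕ→ℚ-* : ∀ a b → ℕ→ℚ (a N.* b) ≡ ℕ→ℚ a * ℕ→ℚ b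
  ℕ→ℚ-* zero    b = sym (QP.*-zeroˡ (ℕ→ℚ b))
  ℕ→ℚ-* (suc a) b = begin
    ℕ→ℚ (b N.+ a N.* b)         ≡⟨ ℕ→ℚ-+ b (a N.* b) ⟩
    ℕ→ℚ b + ℕ→ℚ (a N.* b)       ≡⟨ cong (λ z → ℕ→ℚ b + z) (ℕ→ℚ-* a b) ⟩
    ℕ→ℚ b + ℕ→ℚ a * ℕ→ℚ b       ≡⟨ solve 2 (λ x y → y :+ x :* y := (con 1ℚ :+ x) :* y) refl (ℕ→ℚ a) (ℕ→ℚ b) ⟩
    (1ℚ + ℕ→ℚ a) * ℕ→ℚ b        ≡⟨ cong (_* ℕ→ℚ b) (ℕ→ℚ-suc a) ⟨
    ℕ→ℚ (suc a) * ℕ→ℚ b         ∎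
    where open ≡-Reasoning

  +k/d≡ℕ→ℚk*1/d : ∀ k d → + k / suc d ≡ ℕ→ℚ k * (+ 1 / suc d)
  +k/d≡ℕ→ℚk*1/d k d = QP.toℚᵘ-injective (begin
    Q.toℚᵘ (+ k / suc d)                               ≈⟨ QP.toℚᵘ-fromℚᵘ (U.mkℚᵘ (+ k) d) ⟩
    U.mkℚᵘ (+ k) d                                      ≈⟨ U.*≡* (cong₂ Z._*_ (sym (ZP.*-identityʳ (+ k))) (cong (λ m → + suc m) (NP.+-identityʳ d))) ⟩
    U.mkℚᵘ (+ k) 0 U.* U.mkℚᵘ (+ 1) d                   ≈⟨ UP.*-cong (UP.≃-sym (toℚᵘ-ℕ→ℚ k)) (UP.≃-sym (QP.toℚᵘ-fromℚᵘ (U.mkℚᵘ (+ 1) d))) ⟩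
    Q.toℚᵘ (ℕ→ℚ k) U.* Q.toℚᵘ (+ 1 / suc d)            ≈⟨ UP.≃-sym (QP.toℚᵘ-homo-* (ℕ→ℚ k) (+ 1 / suc d)) ⟩
    Q.toℚᵘ (ℕ→ℚ k * (+ 1 / suc d))                     ∎)
    where open UP.≃-Reasoning

  1/d*d≡1 : ∀ d → (+ 1 / suc d) * ℕ→ℚ (suc d) ≡ 1ℚ
  1/d*d≡1 d = begin
    (+ 1 / suc d) * ℕ→ℚ (suc d)   ≡⟨ QP.*-comm (+ 1 / suc d) (ℕ→ℚ (suc d)) ⟩
    ℕ→ℚ (suc d) * (+ 1 / suc d)   ≡⟨ +k/d≡ℕ→ℚk*1/d (suc d) d ⟨
    + suc d / suc d                ≡⟨ QP.toℚᵘ-injective (UP.≃-trans (QP.toℚᵘ-fromℚᵘ (U.mkℚᵘ (+ suc d) d)) (U.*≡* (ZP.*-comm (+ suc d) (+ 1)))) ⟩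
    1ℚ                             ∎
    where open ≡-Reasoning

module RationalFacts where

  open ℕ→ℚ-Properties
  open Q using (_≤_)
  open QP.≤-Reasoning

  0≤1 : 0ℚ ≤ 1ℚ
  0≤1 = QP.<⇒≤ (QP.positive⁻¹ 1ℚ)

  0≤½ : 0ℚ ≤ ½
  0≤½ = QP.<⇒≤ (QP.positive⁻¹ ½)

  ≤-fromDifference : ∀ {p q} d → q - p ≡ d → 0ℚ ≤ d → p ≤ q
  ≤-fromDifference {p} {q} d q-p≡d 0≤d = begin
    p             ≡⟨ QP.+-identityʳ p ⟨
    p + 0ℚ        ≤⟨ QP.+-monoʳ-≤ p 0≤d ⟩
    p + d         ≡⟨ cong (λ z → p + z) q-p≡d ⟨
    p + (q - p)   ≡⟨ solve 2 (λ x y → x :+ (y :- x) := y) refl p q ⟩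
    q             ∎

  p-q≡0⇒p≡q : ∀ {p q} → p - q ≡ 0ℚ → p ≡ q
  p-q≡0⇒p≡q {p} {q} p-q≡0 = begin-equality
    p              ≡⟨ solve 2 (λ p q → p := (p :- q) :+ q) refl p q ⟩
    (p - q) + q    ≡⟨ cong (_+ q) p-q≡0 ⟩
    0ℚ + q         ≡⟨ QP.+-identityˡ q ⟩
    q              ∎

  p≤q⇒0≤q-p : ∀ {p q} → p ≤ q → 0ℚ ≤ q - p
  p≤q⇒0≤q-p {p} {q} p≤q = begin
    0ℚ     ≡⟨ QP.+-inverseʳ p ⟨
    p - p  ≤⟨ QP.+-monoˡ-≤ (- p) p≤q ⟩
    q - p  ∎

  +-nonNeg : ∀ {p q} → 0ℚ ≤ p → 0ℚ ≤ q → 0ℚ ≤ p + q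
  +-nonNeg = QP.+-mono-≤

  *-monoˡ-≤ : ∀ {r p q} → 0ℚ ≤ r → p ≤ q → r * p ≤ r * q
  *-monoˡ-≤ {r} 0≤r = QP.*-monoˡ-≤-nonNeg r {{Q.nonNegative 0≤r}}

  *-monoʳ-≤ : ∀ {r p q} → 0ℚ ≤ r → p ≤ q → p * r ≤ q * r
  *-monoʳ-≤ {r} 0≤r = QP.*-monoʳ-≤-nonNeg r {{Q.nonNegative 0≤r}}

  *-nonNeg : ∀ {p q} → 0ℚ ≤ p → 0ℚ ≤ q → 0ℚ ≤ p * q
  *-nonNeg {p} {q} 0≤p 0≤q = subst (_≤ p * q) (QP.*-zeroʳ p) (*-monoˡ-≤ {p} {0ℚ} {q} 0≤p 0≤q)

  *-pos : ∀ {p q} → 0ℚ < p → 0ℚ < q → 0ℚ < p * q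
  *-pos {p} {q} 0<p 0<q = subst (_< p * q) (QP.*-zeroʳ p) (QP.*-monoʳ-<-pos p {{Q.positive 0<p}} 0<q)

  ℕ→ℚ-nonNeg : ∀ k → 0ℚ ≤ ℕ→ℚ k
  ℕ→ℚ-nonNeg zero    = QP.≤-refl
  ℕ→ℚ-nonNeg (suc k) = subst (0ℚ ≤_) (sym (ℕ→ℚ-suc k)) (+-nonNeg 0≤1 (ℕ→ℚ-nonNeg k))

  ℕ→ℚ-mono-≤ : ∀ {a b} → a N.≤ b → ℕ→ℚ a ≤ ℕ→ℚ b
  ℕ→ℚ-mono-≤ {a} a≤b with NP.m≤n⇒∃[o]m+o≡n a≤b
  ... | c , refl = ≤-fromDifference (ℕ→ℚ c)
    (trans (cong (_- ℕ→ℚ a) (ℕ→ℚ-+ a c)) (solve 2 (λ x y → x :+ y :- x := y) refl (ℕ→ℚ a) (ℕ→ℚ c)))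
    (ℕ→ℚ-nonNeg c)

  ∣p∣≤q : ∀ {p q} → - q ≤ p → p ≤ q → ∣ p ∣ ≤ q
  ∣p∣≤q {p} {q} -q≤p p≤q with QP.∣p∣≡p∨∣p∣≡-p p
  ... | inj₁ ∣p∣≡p  = subst (_≤ q) (sym ∣p∣≡p) p≤q
  ... | inj₂ ∣p∣≡-p = subst (_≤ q) (sym ∣p∣≡-p)
    (subst (- p ≤_) (solve 1 (λ x → :- (:- x) := x) refl q) (QP.neg-antimono-≤ -q≤p))

  p≤∣p∣ : ∀ p → p ≤ ∣ p ∣
  p≤∣p∣ p with QP.≤-total 0ℚ p
  ... | inj₁ 0≤p = QP.≤-reflexive (sym (QP.0≤p⇒∣p∣≡p 0≤p))
  ... | inj₂ p≤0 = QP.≤-trans p≤0 (QP.0≤∣p∣ p)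

  -∣p∣≤p : ∀ p → - ∣ p ∣ ≤ p
  -∣p∣≤p p = subst (- ∣ p ∣ ≤_) (solve 1 (λ x → :- (:- x) := x) refl p)
    (QP.neg-antimono-≤ (subst (- p ≤_) (QP.∣-p∣≡∣p∣ p) (p≤∣p∣ (- p))))

  ∣p-q∣≤w : ∀ a w {p q} → a ≤ p → p ≤ a + w → a ≤ q → q ≤ a + w → ∣ p - q ∣ ≤ w
  ∣p-q∣≤w a w {p} {q} a≤p p≤a+w a≤q q≤a+w = ∣p∣≤q
    (≤-fromDifference ((p - a) + (a + w - q))
      (solve 4 (λ x y a w → x :- y :- (:- w) := (x :- a) :+ (a :+ w :- y)) refl p q a w)
      (+-nonNeg (p≤q⇒0≤q-p a≤p) (p≤q⇒0≤q-p q≤a+w)))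
    (≤-fromDifference ((a + w - p) + (q - a))
      (solve 4 (λ x y a w → w :- (x :- y) := (a :+ w :- x) :+ (y :- a)) refl p q a w)
      (+-nonNeg (p≤q⇒0≤q-p p≤a+w) (p≤q⇒0≤q-p a≤q)))

  ∣[a+b]-[c+d]∣≤∣a-c∣+∣b-d∣ : ∀ a b c d → ∣ (a + b) - (c + d) ∣ ≤ ∣ a - c ∣ + ∣ b - d ∣
  ∣[a+b]-[c+d]∣≤∣a-c∣+∣b-d∣ a b c d =
    subst (λ z → ∣ z ∣ ≤ ∣ a - c ∣ + ∣ b - d ∣)
      (solve 4 (λ a b c d → (a :- c) :+ (b :- d) := (a :+ b) :- (c :+ d)) refl a b c d)
      (QP.∣p+q∣≤∣p∣+∣q∣ (a - c) (b - d))

  ^-nonNeg : ∀ {p} k → 0ℚ ≤ p → 0ℚ ≤ p ^ k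
  ^-nonNeg zero    0≤p = 0≤1
  ^-nonNeg (suc k) 0≤p = *-nonNeg 0≤p (^-nonNeg k 0≤p)

  ^-pos : ∀ {p} k → 0ℚ < p → 0ℚ < p ^ k
  ^-pos zero    0<p = QP.positive⁻¹ 1ℚ
  ^-pos (suc k) 0<p = *-pos 0<p (^-pos k 0<p)

  ^-≤1 : ∀ {p} k → 0ℚ ≤ p → p ≤ 1ℚ → p ^ k ≤ 1ℚ
  ^-≤1 zero        0≤p p≤1 = QP.≤-refl
  ^-≤1 {p} (suc k) 0≤p p≤1 = begin
    p * p ^ k  ≤⟨ *-monoˡ-≤ 0≤p (^-≤1 k 0≤p p≤1) ⟩
    p * 1ℚ     ≡⟨ QP.*-identityʳ p ⟩
    p          ≤⟨ p≤1 ⟩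
    1ℚ         ∎

  bernoulli : ∀ η k → 0ℚ ≤ η → η ≤ 1ℚ → (1ℚ - η) ^ k * (1ℚ + ℕ→ℚ k * η) ≤ 1ℚ
  bernoulli η zero    _   _   = QP.≤-reflexive (solve 1 (λ e → con 1ℚ :* (con 1ℚ :+ con 0ℚ :* e) := con 1ℚ) refl η)
  bernoulli η (suc k) 0≤η η≤1 = begin
    (1ℚ - η) * q * (1ℚ + ℕ→ℚ (suc k) * η)  ≡⟨ cong (λ z → (1ℚ - η) * q * (1ℚ + z * η)) (ℕ→ℚ-suc k) ⟩
    (1ℚ - η) * q * (1ℚ + (1ℚ + ℕ→ℚ k) * η) ≡⟨ solve 3 (λ e q x → (con 1ℚ :- e) :* q :* (con 1ℚ :+ (con 1ℚ :+ x) :* e)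
                                                        := q :* (con 1ℚ :+ x :* e) :- q :* (e :* e :* (con 1ℚ :+ x)))
                                                  refl η q (ℕ→ℚ k) ⟩
    q * (1ℚ + ℕ→ℚ k * η) - loss             ≤⟨ QP.+-monoʳ-≤ (q * (1ℚ + ℕ→ℚ k * η)) (QP.neg-antimono-≤ 0≤loss) ⟩
    q * (1ℚ + ℕ→ℚ k * η) - 0ℚ               ≡⟨ QP.+-identityʳ _ ⟩
    q * (1ℚ + ℕ→ℚ k * η)                    ≤⟨ bernoulli η k 0≤η η≤1 ⟩
    1ℚ                                       ∎
    where
    q loss : ℚ
    q    = (1ℚ - η) ^ k
    loss = q * (η * η * (1ℚ + ℕ→ℚ k))
    0≤loss : 0ℚ ≤ loss
    0≤loss = *-nonNeg (^-nonNeg k (p≤q⇒0≤q-p η≤1))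
                      (*-nonNeg (*-nonNeg 0≤η 0≤η) (+-nonNeg 0≤1 (ℕ→ℚ-nonNeg k)))

  archimedean : ∀ p → Σ ℕ λ k → p ≤ ℕ→ℚ k
  archimedean (Q.mkℚ (Z.+ m) d _) = m , QP.toℚᵘ-cancel-≤ (UP.≤-respʳ-≃ (UP.≃-sym (toℚᵘ-ℕ→ℚ m))
    (U.*≤* (subst₂ Z._≤_ (sym (ZP.+◃n≡+n (m N.* 1))) (sym (ZP.+◃n≡+n (m N.* suc d)))
                         (Z.+≤+ (NP.*-monoʳ-≤ m (N.s≤s N.z≤n))))))
  archimedean p@(Q.mkℚ Z.-[1+ _ ] _ _) = 0 , QP.<⇒≤ (QP.negative⁻¹ p)

  archimedean-* : ∀ p {c} → 0ℚ < c → Σ ℕ λ k → p ≤ ℕ→ℚ k * c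
  archimedean-* p {c} 0<c = k , (begin
    p                  ≡⟨ QP.*-identityʳ p ⟨
    p * 1ℚ             ≡⟨ cong (p *_) (QP.*-inverseˡ c) ⟨
    p * (Q.1/ c * c)   ≡⟨ QP.*-assoc p (Q.1/ c) c ⟨
    p * Q.1/ c * c     ≤⟨ *-monoʳ-≤ (QP.<⇒≤ 0<c) p/c≤k ⟩
    ℕ→ℚ k * c          ∎)
    where
    instance
      c≢0 : Q.NonZero c
      c≢0 = QP.pos⇒nonZero c {{Q.positive 0<c}}
    k : ℕ
    k = proj₁ (archimedean (p * Q.1/ c))
    p/c≤k : p * Q.1/ c ≤ ℕ→ℚ k
    p/c≤k = proj₂ (archimedean (p * Q.1/ c))

  geometric-decay : ∀ B {ε η} → 0ℚ < ε → 0ℚ < η → η ≤ 1ℚ → Σ ℕ λ k → (1ℚ - η) ^ k * B ≤ ε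
  geometric-decay B {ε} {η} 0<ε 0<η η≤1 = k , (begin
    q * B                        ≤⟨ *-monoˡ-≤ 0≤q B≤kηε ⟩
    q * (ℕ→ℚ k * (η * ε))        ≤⟨ *-monoˡ-≤ 0≤q kηε≤[1+kη]ε ⟩
    q * ((1ℚ + ℕ→ℚ k * η) * ε)   ≡⟨ QP.*-assoc q (1ℚ + ℕ→ℚ k * η) ε ⟨
    q * (1ℚ + ℕ→ℚ k * η) * ε     ≤⟨ *-monoʳ-≤ (QP.<⇒≤ 0<ε) (bernoulli η k (QP.<⇒≤ 0<η) η≤1) ⟩
    1ℚ * ε                       ≡⟨ QP.*-identityˡ ε ⟩
    ε                            ∎)
    where
    k : ℕ
    k = proj₁ (archimedean-* B (*-pos 0<η 0<ε))
    B≤kηε : B ≤ ℕ→ℚ k * (η * ε)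
    B≤kηε = proj₂ (archimedean-* B (*-pos 0<η 0<ε))
    q : ℚ
    q = (1ℚ - η) ^ k
    0≤q : 0ℚ ≤ q
    0≤q = ^-nonNeg k (p≤q⇒0≤q-p η≤1)
    kηε≤[1+kη]ε : ℕ→ℚ k * (η * ε) ≤ (1ℚ + ℕ→ℚ k * η) * ε
    kηε≤[1+kη]ε = ≤-fromDifference ε
      (solve 3 (λ x e z → (con 1ℚ :+ x :* e) :* z :- x :* (e :* z) := z) refl (ℕ→ℚ k) η ε)
      (QP.<⇒≤ 0<ε)

module FiniteSums where

  open RationalFacts
  open Q using (_≤_)
  open ≡-Reasoning

  sumℚ-cong : ∀ m {f g : Fin m → ℚ} → (∀ i → f i ≡ g i) → sumℚ m f ≡ sumℚ m g
  sumℚ-cong zero    f≡g = refl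
  sumℚ-cong (suc m) f≡g = cong₂ _+_ (f≡g zero) (sumℚ-cong m (λ i → f≡g (suc i)))

  sumℚ-+ : ∀ m (f g : Fin m → ℚ) → sumℚ m (λ i → f i + g i) ≡ sumℚ m f + sumℚ m g
  sumℚ-+ zero    f g = refl
  sumℚ-+ (suc m) f g = begin
    (f zero + g zero) + sumℚ m (λ i → f (suc i) + g (suc i))  ≡⟨ cong (λ z → (f zero + g zero) + z) (sumℚ-+ m (λ i → f (suc i)) (λ i → g (suc i))) ⟩
    (f zero + g zero) + (Sf + Sg)                               ≡⟨ solve 4 (λ a b c d → a :+ b :+ (c :+ d) := a :+ c :+ (b :+ d)) refl (f zero) (g zero) Sf Sg ⟩
    (f zero + Sf) + (g zero + Sg)                               ∎
    where
    Sf Sg : ℚ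
    Sf = sumℚ m (λ i → f (suc i))
    Sg = sumℚ m (λ i → g (suc i))

  sumℚ-*ˡ : ∀ m c (f : Fin m → ℚ) → sumℚ m (λ i → c * f i) ≡ c * sumℚ m f
  sumℚ-*ˡ zero    c f = sym (QP.*-zeroʳ c)
  sumℚ-*ˡ (suc m) c f = trans (cong (λ z → c * f zero + z) (sumℚ-*ˡ m c (λ i → f (suc i))))
                              (sym (QP.*-distribˡ-+ c (f zero) _))

  sumℚ-const : ∀ m c → sumℚ m (λ _ → c) ≡ ℕ→ℚ m * c
  sumℚ-const zero    c = sym (QP.*-zeroˡ c)
  sumℚ-const (suc m) c = begin
    c + sumℚ m (λ _ → c)   ≡⟨ cong (λ z → c + z) (sumℚ-const m c) ⟩
    c + ℕ→ℚ m * c          ≡⟨ solve 2 (λ x y → y :+ x :* y := (con 1ℚ :+ x) :* y) refl (ℕ→ℚ m) c ⟩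
    (1ℚ + ℕ→ℚ m) * c       ≡⟨ cong (_* c) (ℕ→ℚ-Properties.ℕ→ℚ-suc m) ⟨
    ℕ→ℚ (suc m) * c        ∎

  sumℚ-zero : ∀ m → sumℚ m (λ _ → 0ℚ) ≡ 0ℚ
  sumℚ-zero m = trans (sumℚ-const m 0ℚ) (QP.*-zeroʳ (ℕ→ℚ m))

  sumℚ-affine : ∀ m α γ (f : Fin m → ℚ) → sumℚ m (λ i → α * f i + γ) ≡ α * sumℚ m f + ℕ→ℚ m * γ
  sumℚ-affine m α γ f = trans (sumℚ-+ m _ _) (cong₂ _+_ (sumℚ-*ˡ m α f) (sumℚ-const m γ))

  sumℚ-linear : ∀ m α β (f g k : Fin m → ℚ) →
                sumℚ m (λ i → α * f i + β * g i + k i) ≡ α * sumℚ m f + β * sumℚ m g + sumℚ m k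
  sumℚ-linear m α β f g k = trans (sumℚ-+ m _ k) (cong (_+ sumℚ m k)
    (trans (sumℚ-+ m _ _) (cong₂ _+_ (sumℚ-*ˡ m α f) (sumℚ-*ˡ m β g))))

  sumℚ-swap : ∀ m k (f : Fin m → Fin k → ℚ) →
              sumℚ m (λ i → sumℚ k (f i)) ≡ sumℚ k (λ j → sumℚ m (λ i → f i j))
  sumℚ-swap zero    k f = sym (sumℚ-zero k)
  sumℚ-swap (suc m) k f = trans (cong (λ z → sumℚ k (f zero) + z) (sumℚ-swap m k (λ i → f (suc i))))
                                (sym (sumℚ-+ k (f zero) _))

  sumℚ-count : ∀ m (p : Fin m → Bool) c → sumℚ m (λ i → if p i then c else 0ℚ) ≡ ℕ→ℚ (count m p) * c
  sumℚ-count zero    p c = sym (QP.*-zeroˡ c)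
  sumℚ-count (suc m) p c with p zero
  ... | true  = begin
    c + sumℚ m (λ i → if p (suc i) then c else 0ℚ)  ≡⟨ cong (λ z → c + z) (sumℚ-count m (λ i → p (suc i)) c) ⟩
    c + ℕ→ℚ k * c                                    ≡⟨ solve 2 (λ x y → y :+ x :* y := (con 1ℚ :+ x) :* y) refl (ℕ→ℚ k) c ⟩
    (1ℚ + ℕ→ℚ k) * c                                 ≡⟨ cong (_* c) (ℕ→ℚ-Properties.ℕ→ℚ-suc k) ⟨
    ℕ→ℚ (suc k) * c                                  ∎
    where
    k : ℕ
    k = count m (λ i → p (suc i))
  ... | false = trans (QP.+-identityˡ _) (sumℚ-count m (λ i → p (suc i)) c)

  sumℚ-single : ∀ m {f : Fin m → ℚ} i → (∀ j → ¬ j ≡ i → f j ≡ 0ℚ) → sumℚ m f ≡ f i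
  sumℚ-single (suc m) {f} zero    f≡0 =
    trans (cong (λ z → f zero + z) (trans (sumℚ-cong m (λ j → f≡0 (suc j) (λ ()))) (sumℚ-zero m)))
          (QP.+-identityʳ (f zero))
  sumℚ-single (suc m) {f} (suc i) f≡0 =
    trans (cong₂ _+_ (f≡0 zero (λ ())) (sumℚ-single m i (λ j j≢i → f≡0 (suc j) (j≢i ∘ FinP.suc-injective))))
          (QP.+-identityˡ (f (suc i)))

  kronecker-≡ : ∀ {m} (i : Fin m) {c} → (if ⌊ i ≟ i ⌋ then c else 0ℚ) ≡ c
  kronecker-≡ i with i ≟ i
  ... | yes _   = refl
  ... | no i≢i = ⊥-elim (i≢i refl)

  kronecker-≢ : ∀ {m} {i j : Fin m} {c} → ¬ i ≡ j → (if ⌊ i ≟ j ⌋ then c else 0ℚ) ≡ 0ℚ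
  kronecker-≢ {i = i} {j} i≢j with i ≟ j
  ... | yes i≡j = ⊥-elim (i≢j i≡j)
  ... | no _    = refl

  sumℚ-kronecker : ∀ m i c → sumℚ m (λ j → if ⌊ i ≟ j ⌋ then c else 0ℚ) ≡ c
  sumℚ-kronecker m i c = trans (sumℚ-single m i (λ _ j≢i → kronecker-≢ (j≢i ∘ sym))) (kronecker-≡ i)

  sumℚ-mono-≤ : ∀ m {f g : Fin m → ℚ} → (∀ i → f i ≤ g i) → sumℚ m f ≤ sumℚ m g
  sumℚ-mono-≤ zero    f≤g = QP.≤-refl
  sumℚ-mono-≤ (suc m) f≤g = QP.+-mono-≤ (f≤g zero) (sumℚ-mono-≤ m (λ i → f≤g (suc i)))

  sumℚ-nonNeg : ∀ m {f : Fin m → ℚ} → (∀ i → 0ℚ ≤ f i) → 0ℚ ≤ sumℚ m f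
  sumℚ-nonNeg m {f} 0≤f = subst (_≤ sumℚ m f) (sumℚ-zero m) (sumℚ-mono-≤ m 0≤f)

  term≤sumℚ : ∀ m {f : Fin m → ℚ} i → (∀ j → 0ℚ ≤ f j) → f i ≤ sumℚ m f
  term≤sumℚ (suc m) {f} zero    0≤f =
    subst (_≤ sumℚ (suc m) f) (QP.+-identityʳ (f zero))
          (QP.+-monoʳ-≤ (f zero) (sumℚ-nonNeg m (λ j → 0≤f (suc j))))
  term≤sumℚ (suc m) {f} (suc i) 0≤f =
    subst (_≤ sumℚ (suc m) f) (QP.+-identityˡ (f (suc i)))
          (QP.+-mono-≤ (0≤f zero) (term≤sumℚ m i (λ j → 0≤f (suc j))))

  f≤maxℕ : ∀ m (f : Fin m → ℕ) i → f i N.≤ maxℕ m f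
  f≤maxℕ (suc m) f zero    = NP.m≤m⊔n (f zero) _
  f≤maxℕ (suc m) f (suc i) = NP.≤-trans (f≤maxℕ m (λ j → f (suc j)) i) (NP.m≤n⊔m (f zero) _)

  f≤maxℚ : ∀ m (f : Fin m → ℚ) i → f i ≤ maxℚ m f
  f≤maxℚ (suc m) f zero    = QP.p≤p⊔q (f zero) _
  f≤maxℚ (suc m) f (suc i) = QP.≤-trans (f≤maxℚ m (λ j → f (suc j)) i) (QP.p≤q⊔p (f zero) _)

  count-pos : ∀ m (p : Fin m → Bool) i → p i ≡ true → 1 N.≤ count m p
  count-pos (suc m) p zero    pi≡true rewrite pi≡true = N.s≤s N.z≤n
  count-pos (suc m) p (suc i) pi≡true = NP.≤-trans (count-pos m (λ j → p (suc j)) i pi≡true) (NP.m≤n+m _ _)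

reach-length : ∀ {n} {G : SimpleGraph n} {u v} → Reach G u v → ℕ
reach-length here        = 0
reach-length (there _ r) = suc (reach-length r)

module StochasticMatrix {n : ℕ} (P : Fin n → Fin n → ℚ)
                        (P-nonNeg : ∀ i j → 0ℚ Q.≤ P i j)
                        (P-rowSum : ∀ i → sumℚ n (P i) ≡ 1ℚ) where

  open RationalFacts
  open FiniteSums
  open Q using (_≤_)
  open QP.≤-Reasoning

  apply : (Fin n → ℚ) → Fin n → ℚ
  apply x i = sumℚ n (λ j → P i j * x j)

  iterate : ℕ → (Fin n → ℚ) → Fin n → ℚ
  iterate zero    x = x
  iterate (suc t) x = apply (iterate t x)

  apply-cong : ∀ {x y} → (∀ j → x j ≡ y j) → ∀ i → apply x i ≡ apply y i
  apply-cong x≡y i = sumℚ-cong n (λ j → cong (P i j *_) (x≡y j))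

  apply-+ : ∀ x y i → apply (λ j → x j + y j) i ≡ apply x i + apply y i
  apply-+ x y i = trans (sumℚ-cong n (λ j → QP.*-distribˡ-+ (P i j) (x j) (y j)))
                        (sumℚ-+ n (λ j → P i j * x j) (λ j → P i j * y j))

  apply-*ˡ : ∀ α x i → apply (λ j → α * x j) i ≡ α * apply x i
  apply-*ˡ α x i = trans (sumℚ-cong n (λ j → solve 3 (λ p a y → p :* (a :* y) := a :* (p :* y)) refl (P i j) α (x j)))
                         (sumℚ-*ˡ n α (λ j → P i j * x j))

  apply-const : ∀ γ i → apply (λ _ → γ) i ≡ γ
  apply-const γ i = begin-equality
    sumℚ n (λ j → P i j * γ)   ≡⟨ sumℚ-cong n (λ j → QP.*-comm (P i j) γ) ⟩
    sumℚ n (λ j → γ * P i j)   ≡⟨ sumℚ-*ˡ n γ (P i) ⟩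
    γ * sumℚ n (P i)           ≡⟨ cong (γ *_) (P-rowSum i) ⟩
    γ * 1ℚ                     ≡⟨ QP.*-identityʳ γ ⟩
    γ                          ∎

  apply-affine : ∀ α γ x i → apply (λ j → α * x j + γ) i ≡ α * apply x i + γ
  apply-affine α γ x i = trans (apply-+ (λ j → α * x j) (λ _ → γ) i) (cong₂ _+_ (apply-*ˡ α x i) (apply-const γ i))

  iterate-affine : ∀ t α γ x i → iterate t (λ j → α * x j + γ) i ≡ α * iterate t x i + γ
  iterate-affine zero    α γ x i = refl
  iterate-affine (suc t) α γ x i =
    trans (apply-cong (iterate-affine t α γ x) i) (apply-affine α γ (iterate t x) i)

  apply-mono-≤ : ∀ {x y} → (∀ j → x j ≤ y j) → ∀ i → apply x i ≤ apply y i
  apply-mono-≤ x≤y i = sumℚ-mono-≤ n (λ j → *-monoˡ-≤ (P-nonNeg i j) (x≤y j))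

  iterate-mono-≤ : ∀ t {x y} → (∀ j → x j ≤ y j) → ∀ i → iterate t x i ≤ iterate t y i
  iterate-mono-≤ zero    x≤y = x≤y
  iterate-mono-≤ (suc t) x≤y = apply-mono-≤ (iterate-mono-≤ t x≤y)

  iterate-nonNeg : ∀ t {x} → (∀ j → 0ℚ ≤ x j) → ∀ i → 0ℚ ≤ iterate t x i
  iterate-nonNeg zero    0≤x = 0≤x
  iterate-nonNeg (suc t) 0≤x i = sumℚ-nonNeg n (λ j → *-nonNeg (P-nonNeg i j) (iterate-nonNeg t 0≤x j))

  iterate-+ : ∀ s t x i → iterate (s N.+ t) x i ≡ iterate s (iterate t x) i
  iterate-+ zero    t x i = refl
  iterate-+ (suc s) t x i = apply-cong (iterate-+ s t x) i

  indicator : Fin n → Fin n → ℚ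
  indicator v i = if ⌊ i ≟ v ⌋ then 1ℚ else 0ℚ

  indicator-nonNeg : ∀ v i → 0ℚ ≤ indicator v i
  indicator-nonNeg v i with i ≟ v
  ... | yes _ = 0≤1
  ... | no _  = QP.≤-refl

  Within : (Fin n → ℚ) → ℚ → ℚ → Set
  Within x a w = (∀ i → a ≤ x i) × (∀ i → x i ≤ a + w)

  Within-resp : ∀ {x y a w w′} → (∀ i → x i ≡ y i) → w ≡ w′ → Within x a w → Within y a w′
  Within-resp {a = a} x≡y refl (a≤x , x≤a+w) =
    (λ i → subst (a ≤_) (x≡y i) (a≤x i)) , (λ i → subst (_≤ _) (x≡y i) (x≤a+w i))

  module Doeblin {v : Fin n} {K : ℕ} {η : ℚ} (η≤Pᴷ : ∀ i → η ≤ iterate K (indicator v) i) where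

    -- x lies between the affine envelopes a + c·e_v and (a + w) − (w − c)·e_v,
    -- which touch x at v; P^K preserves both and maps e_v to values ≥ η.
    contraction : ∀ {x a w} → Within x a w → Σ ℚ λ a′ → Within (iterate K x) a′ ((1ℚ - η) * w)
    contraction {x} {a} {w} (a≤x , x≤a+w) = a + c * η , lower , upper
      where
      c : ℚ
      c = x v - a
      e : Fin n → ℚ
      e = indicator v

      below : ∀ j → c * e j + a ≤ x j
      below j with j ≟ v
      ... | yes refl = QP.≤-reflexive (solve 2 (λ y a → (y :- a) :* con 1ℚ :+ a := y) refl (x v) a)
      ... | no _     = subst (_≤ x j) (solve 2 (λ c a → a := c :* con 0ℚ :+ a) refl c a) (a≤x j)

      above : ∀ j → x j ≤ (c - w) * e j + (a + w)
      above j with j ≟ v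
      ... | yes refl = QP.≤-reflexive (solve 3 (λ y a w → y := (y :- a :- w) :* con 1ℚ :+ (a :+ w)) refl (x v) a w)
      ... | no _     = subst (x j ≤_) (solve 2 (λ d b → b := d :* con 0ℚ :+ b) refl (c - w) (a + w)) (x≤a+w j)

      lower : ∀ i → a + c * η ≤ iterate K x i
      lower i = begin
        a + c * η                         ≤⟨ QP.+-monoʳ-≤ a (*-monoˡ-≤ (p≤q⇒0≤q-p (a≤x v)) (η≤Pᴷ i)) ⟩
        a + c * iterate K e i             ≡⟨ QP.+-comm a _ ⟩
        c * iterate K e i + a             ≡⟨ iterate-affine K c a e i ⟨
        iterate K (λ j → c * e j + a) i   ≤⟨ iterate-mono-≤ K below i ⟩
        iterate K x i                     ∎

      upper : ∀ i → iterate K x i ≤ a + c * η + (1ℚ - η) * w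
      upper i = begin
        iterate K x i                                 ≤⟨ iterate-mono-≤ K above i ⟩
        iterate K (λ j → (c - w) * e j + (a + w)) i   ≡⟨ iterate-affine K (c - w) (a + w) e i ⟩
        (c - w) * p + (a + w)                         ≤⟨ QP.+-monoˡ-≤ (a + w) [c-w]p≤[c-w]η ⟩
        (c - w) * η + (a + w)                         ≡⟨ solve 4 (λ c w a e → (c :- w) :* e :+ (a :+ w) := a :+ c :* e :+ (con 1ℚ :- e) :* w) refl c w a η ⟩
        a + c * η + (1ℚ - η) * w                      ∎
        where
        p : ℚ
        p = iterate K e i
        [c-w]p≤[c-w]η : (c - w) * p ≤ (c - w) * η
        [c-w]p≤[c-w]η = ≤-fromDifference ((a + w - x v) * (p - η))
          (solve 5 (λ y a w p e → (y :- a :- w) :* e :- (y :- a :- w) :* p := (a :+ w :- y) :* (p :- e)) refl (x v) a w p η)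
          (*-nonNeg (p≤q⇒0≤q-p (x≤a+w v)) (p≤q⇒0≤q-p (η≤Pᴷ i)))

    contraction-iterate : ∀ k {x a w} → Within x a w →
                          Σ ℚ λ a′ → Within (iterate (k N.* K) x) a′ ((1ℚ - η) ^ k * w)
    contraction-iterate zero    {w = w} x∈ = _ , Within-resp (λ _ → refl) (sym (QP.*-identityˡ w)) x∈
    contraction-iterate (suc k) {x} {w = w} x∈ =
      let a′ , y∈ = contraction-iterate k x∈
          a″ , z∈ = contraction y∈
      in a″ , Within-resp (λ i → sym (iterate-+ K (k N.* K) x i))
                          (sym (QP.*-assoc (1ℚ - η) ((1ℚ - η) ^ k) w)) z∈

  module _ (G : SimpleGraph n) {δ : ℚ} (0≤δ : 0ℚ ≤ δ)
           (δ≤P-edge : ∀ i j → SimpleGraph.adj G i j ≡ true → δ ≤ P i j)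
           {v : Fin n} (δ≤Pvv : δ ≤ P v v) where

    private
      step : ∀ m {i} j {x} → (∀ k → 0ℚ ≤ x k) → δ ≤ P i j → δ ^ m ≤ x j → δ ^ suc m ≤ apply x i
      step m {i} j {x} 0≤x δ≤Pij δᵐ≤xj = begin
        δ * δ ^ m  ≤⟨ *-monoʳ-≤ (^-nonNeg m 0≤δ) δ≤Pij ⟩
        P i j * δ ^ m ≤⟨ *-monoˡ-≤ (P-nonNeg i j) δᵐ≤xj ⟩
        P i j * x j   ≤⟨ term≤sumℚ n j (λ k → *-nonNeg (P-nonNeg i k) (0≤x k)) ⟩
        apply x i     ∎

    δ^m≤iterate-indicator : ∀ {i} (r : Reach G i v) m → reach-length r N.≤ m → δ ^ m ≤ iterate m (indicator v) i
    δ^m≤iterate-indicator here zero _ = QP.≤-reflexive (sym (kronecker-≡ v))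
    δ^m≤iterate-indicator here (suc m) _ =
      step m v (iterate-nonNeg m (indicator-nonNeg v)) δ≤Pvv (δ^m≤iterate-indicator here m N.z≤n)
    δ^m≤iterate-indicator (there {w = w} i~w r) (suc m) (N.s≤s ∣r∣≤m) =
      step m w (iterate-nonNeg m (indicator-nonNeg v)) (δ≤P-edge _ w i~w) (δ^m≤iterate-indicator r m ∣r∣≤m)

  occupation : Fin n → ℕ → Fin n → ℚ
  occupation v zero    i = 0ℚ
  occupation v (suc T) i = occupation v T i + iterate T (indicator v) i

  apply-occupation : ∀ v T i → apply (occupation v T) i + indicator v i ≡ occupation v (suc T) i
  apply-occupation v zero    i = cong (_+ indicator v i) (apply-const 0ℚ i)
  apply-occupation v (suc T) i = begin-equality
    apply (λ j → occupation v T j + iterate T e j) i + e i   ≡⟨ cong (_+ e i) (apply-+ (occupation v T) (iterate T e) i) ⟩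
    apply (occupation v T) i + iterate (suc T) e i + e i    ≡⟨ solve 3 (λ a b c → a :+ b :+ c := a :+ c :+ b) refl (apply (occupation v T) i) (iterate (suc T) e i) (e i) ⟩
    apply (occupation v T) i + e i + iterate (suc T) e i    ≡⟨ cong (_+ iterate (suc T) e i) (apply-occupation v T i) ⟩
    occupation v (suc T) i + iterate (suc T) e i            ∎
    where
    e : Fin n → ℚ
    e = indicator v

  module DoublyStochastic (P-colSum : ∀ j → sumℚ n (λ i → P i j) ≡ 1ℚ) where

    sumℚ-apply : ∀ x → sumℚ n (apply x) ≡ sumℚ n x
    sumℚ-apply x = trans (sumℚ-swap n n (λ i j → P i j * x j)) (sumℚ-cong n column)
      where
      column : ∀ j → sumℚ n (λ i → P i j * x j) ≡ x j
      column j = begin-equality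
        sumℚ n (λ i → P i j * x j)   ≡⟨ sumℚ-cong n (λ i → QP.*-comm (P i j) (x j)) ⟩
        sumℚ n (λ i → x j * P i j)   ≡⟨ sumℚ-*ˡ n (x j) (λ i → P i j) ⟩
        x j * sumℚ n (λ i → P i j)   ≡⟨ cong (x j *_) (P-colSum j) ⟩
        x j * 1ℚ                     ≡⟨ QP.*-identityʳ (x j) ⟩
        x j                          ∎

    module HittingTime {v : Fin n} {h : Fin n → ℚ}
                       (h-step : ∀ u → ¬ u ≡ v → h u ≡ 1ℚ + apply h u) where

      private
        e : Fin n → ℚ
        e = indicator v
        N : ℚ
        N = ℕ→ℚ n
        defect : Fin n → ℚ
        defect i = apply h i - (h i - 1ℚ + N * e i)

        defect-≢ : ∀ i → ¬ i ≡ v → defect i ≡ 0ℚ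
        defect-≢ i i≢v = begin-equality
          apply h i - (h i - 1ℚ + N * e i)                     ≡⟨ cong₂ (λ y x → apply h i - (y - 1ℚ + N * x)) (h-step i i≢v) (kronecker-≢ i≢v) ⟩
          apply h i - ((1ℚ + apply h i) - 1ℚ + N * 0ℚ)         ≡⟨ solve 2 (λ p m → p :- ((con 1ℚ :+ p) :- con 1ℚ :+ m :* con 0ℚ) := con 0ℚ) refl (apply h i) N ⟩
          0ℚ                                                   ∎

        sumℚ-defect : sumℚ n defect ≡ 0ℚ
        sumℚ-defect = begin-equality
          sumℚ n defect
            ≡⟨ sumℚ-cong n (λ i → solve 4 (λ p y x m → p :- (y :- con 1ℚ :+ m :* x) := (p :+ (:- con 1ℚ) :* y) :+ ((:- m) :* x :+ con 1ℚ)) refl (apply h i) (h i) (e i) N) ⟩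
          sumℚ n (λ i → (apply h i + (- 1ℚ) * h i) + ((- N) * e i + 1ℚ))
            ≡⟨ sumℚ-+ n _ _ ⟩
          sumℚ n (λ i → apply h i + (- 1ℚ) * h i) + sumℚ n (λ i → (- N) * e i + 1ℚ)
            ≡⟨ cong₂ _+_ (trans (sumℚ-+ n _ _) (cong₂ _+_ (sumℚ-apply h) (sumℚ-*ˡ n (- 1ℚ) h))) (sumℚ-affine n (- N) 1ℚ e) ⟩
          (sumℚ n h + (- 1ℚ) * sumℚ n h) + ((- N) * sumℚ n e + N * 1ℚ)
            ≡⟨ cong (λ z → (sumℚ n h + (- 1ℚ) * sumℚ n h) + ((- N) * z + N * 1ℚ)) (trans (sumℚ-single n v (λ _ → kronecker-≢)) (kronecker-≡ v)) ⟩
          (sumℚ n h + (- 1ℚ) * sumℚ n h) + ((- N) * 1ℚ + N * 1ℚ)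
            ≡⟨ solve 2 (λ s m → (s :+ (:- con 1ℚ) :* s) :+ ((:- m) :* con 1ℚ :+ m :* con 1ℚ) := con 0ℚ) refl (sumℚ n h) N ⟩
          0ℚ ∎

        defect-≡ : defect v ≡ 0ℚ
        defect-≡ = trans (sym (sumℚ-single n v defect-≢)) sumℚ-defect

        defect≡0 : ∀ {i} → Dec (i ≡ v) → defect i ≡ 0ℚ
        defect≡0     (yes refl) = defect-≡
        defect≡0 {i} (no i≢v)   = defect-≢ i i≢v

      -- Off v this is the first-step equation; at v it holds because P
      -- preserves sums, so the defects sum to zero.
      apply-hitting : ∀ i → apply h i ≡ h i - 1ℚ + ℕ→ℚ n * indicator v i
      apply-hitting i = p-q≡0⇒p≡q (defect≡0 (i ≟ v))

      h+n*occupation≡iterate+T : ∀ T i → h i + ℕ→ℚ n * occupation v T i ≡ iterate T h i + ℕ→ℚ T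
      h+n*occupation≡iterate+T zero    i = cong (λ z → h i + z) (QP.*-zeroʳ N)
      h+n*occupation≡iterate+T (suc T) i = begin-equality
        h i + N * occupation v (suc T) i                    ≡⟨ cong (λ z → h i + N * z) (apply-occupation v T i) ⟨
        h i + N * (g i + e i)                               ≡⟨ solve 4 (λ y m g e → y :+ m :* (g :+ e) := (y :- con 1ℚ :+ m :* e) :+ m :* g :+ con 1ℚ) refl (h i) N (g i) (e i) ⟩
        (h i - 1ℚ + N * e i) + N * g i + 1ℚ                 ≡⟨ cong (λ z → z + N * g i + 1ℚ) (apply-hitting i) ⟨
        apply h i + N * g i + 1ℚ                            ≡⟨ cong (_+ 1ℚ) (trans (apply-+ h _ i) (cong (λ z → apply h i + z) (apply-*ˡ N (occupation v T) i))) ⟨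
        apply (λ j → h j + N * occupation v T j) i + 1ℚ     ≡⟨ cong (_+ 1ℚ) (apply-cong (h+n*occupation≡iterate+T T) i) ⟩
        apply (λ j → iterate T h j + ℕ→ℚ T) i + 1ℚ         ≡⟨ cong (_+ 1ℚ) (trans (apply-+ (iterate T h) _ i) (cong (λ z → iterate (suc T) h i + z) (apply-const (ℕ→ℚ T) i))) ⟩
        iterate (suc T) h i + ℕ→ℚ T + 1ℚ                    ≡⟨ solve 2 (λ x t → x :+ t :+ con 1ℚ := x :+ (con 1ℚ :+ t)) refl (iterate (suc T) h i) (ℕ→ℚ T) ⟩
        iterate (suc T) h i + (1ℚ + ℕ→ℚ T)                  ≡⟨ cong (λ z → iterate (suc T) h i + z) (ℕ→ℚ-Properties.ℕ→ℚ-suc T) ⟨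
        iterate (suc T) h i + ℕ→ℚ (suc T)                   ∎
        where
        g : Fin n → ℚ
        g = apply (occupation v T)

module SymmetricWalk {n : ℕ} (G : SimpleGraph n) where

  open SimpleGraph G
  open ℕ→ℚ-Properties
  open RationalFacts
  open FiniteSums
  open Q using (_≤_)
  open QP.≤-Reasoning

  Δ : ℕ
  Δ = maxDeg G

  -- Opaque, so that with-abstraction and unification never unfold the gcd
  -- normalisation hidden in + 1 / suc Δ and ℕ→ℚ.
  opaque
    δ : ℚ
    δ = Z.+ 1 / suc Δ

    degℚ : Fin n → ℚ
    degℚ u = ℕ→ℚ (deg G u)

    δ≡ : δ ≡ Z.+ 1 / suc Δ
    δ≡ = refl

    degℚ≡ : ∀ u → degℚ u ≡ ℕ→ℚ (deg G u)
    degℚ≡ u = refl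

  0<δ : 0ℚ < δ
  0<δ = subst (0ℚ <_) (sym δ≡) (QP.positive⁻¹ _ {{QP.normalize-pos 1 (suc Δ)}})

  δ*[1+Δ]≡1 : δ * ℕ→ℚ (suc Δ) ≡ 1ℚ
  δ*[1+Δ]≡1 = trans (cong (_* ℕ→ℚ (suc Δ)) δ≡) (1/d*d≡1 Δ)

  δ≤1 : δ ≤ 1ℚ
  δ≤1 = begin
    δ                    ≡⟨ QP.*-identityʳ δ ⟨
    δ * 1ℚ               ≤⟨ *-monoˡ-≤ (QP.<⇒≤ 0<δ) (ℕ→ℚ-mono-≤ {1} {suc Δ} (N.s≤s N.z≤n)) ⟩
    δ * ℕ→ℚ (suc Δ)      ≡⟨ δ*[1+Δ]≡1 ⟩
    1ℚ                   ∎

  deg≤Δ : ∀ u → deg G u N.≤ Δ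
  deg≤Δ = f≤maxℕ n (deg G)

  degℚ≤Δ : ∀ u → degℚ u ≤ ℕ→ℚ Δ
  degℚ≤Δ u = subst (_≤ ℕ→ℚ Δ) (sym (degℚ≡ u)) (ℕ→ℚ-mono-≤ (deg≤Δ u))

  degℚ-nonNeg : ∀ u → 0ℚ ≤ degℚ u
  degℚ-nonNeg u = subst (0ℚ ≤_) (sym (degℚ≡ u)) (ℕ→ℚ-nonNeg (deg G u))

  δ≤1-degℚ*δ : ∀ u → δ ≤ 1ℚ - degℚ u * δ
  δ≤1-degℚ*δ u = ≤-fromDifference ((ℕ→ℚ Δ - degℚ u) * δ)
    (begin-equality
      1ℚ - degℚ u * δ - δ                       ≡⟨ cong (λ z → z - degℚ u * δ - δ) δ*[1+Δ]≡1 ⟨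
      δ * ℕ→ℚ (suc Δ) - degℚ u * δ - δ          ≡⟨ cong (λ z → δ * z - degℚ u * δ - δ) (ℕ→ℚ-suc Δ) ⟩
      δ * (1ℚ + ℕ→ℚ Δ) - degℚ u * δ - δ         ≡⟨ solve 3 (λ e m x → e :* (con 1ℚ :+ m) :- x :* e :- e := (m :- x) :* e) refl δ (ℕ→ℚ Δ) (degℚ u) ⟩
      (ℕ→ℚ Δ - degℚ u) * δ                      ∎)
    (*-nonNeg (p≤q⇒0≤q-p (degℚ≤Δ u)) (QP.<⇒≤ 0<δ))

  diagonal : Fin n → Fin n → ℚ
  diagonal i j = if ⌊ i ≟ j ⌋ then 1ℚ - degℚ i * δ else 0ℚ

  P'≡ : ∀ i j → P' G i j ≡ (if adj i j then δ else diagonal i j)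
  P'≡ i j = cong₂ (λ a b → if adj i j then a else (if ⌊ i ≟ j ⌋ then 1ℚ - b else 0ℚ))
    (sym δ≡) (trans (+k/d≡ℕ→ℚk*1/d (deg G i) Δ) (cong₂ _*_ (sym (degℚ≡ i)) (sym δ≡)))

  adj⇒≢ : ∀ {i j} → adj i j ≡ true → ¬ i ≡ j
  adj⇒≢ {i} i~i refl with () ← trans (sym i~i) (loopless i)

  P'-edge : ∀ {i j} → adj i j ≡ true → P' G i j ≡ δ
  P'-edge {i} {j} i~j = trans (P'≡ i j) (cong (if_then δ else diagonal i j) i~j)

  P'-diag : ∀ i → P' G i i ≡ 1ℚ - degℚ i * δ
  P'-diag i = trans (P'≡ i i) (trans (cong (if_then δ else diagonal i i) (loopless i)) (kronecker-≡ i))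

  P'-off : ∀ {i j} → adj i j ≡ false → ¬ i ≡ j → P' G i j ≡ 0ℚ
  P'-off {i} {j} i≁j i≢j = trans (P'≡ i j) (trans (cong (if_then δ else diagonal i j) i≁j) (kronecker-≢ i≢j))

  P'-split : ∀ i j → P' G i j ≡ (if adj i j then δ else 0ℚ) + diagonal i j
  P'-split i j = trans (P'≡ i j) split
    where
    split : (if adj i j then δ else diagonal i j) ≡ (if adj i j then δ else 0ℚ) + diagonal i j
    split with adj i j in i~j
    ... | true  = sym (trans (cong (δ +_) (kronecker-≢ (adj⇒≢ i~j))) (QP.+-identityʳ δ))
    ... | false = sym (QP.+-identityˡ (diagonal i j))

  diagonal-nonNeg : ∀ i j → 0ℚ ≤ diagonal i j
  diagonal-nonNeg i j with i ≟ j
  ... | yes _ = QP.≤-trans (QP.<⇒≤ 0<δ) (δ≤1-degℚ*δ i)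
  ... | no _  = QP.≤-refl

  diagonal-sym : ∀ i j → diagonal i j ≡ diagonal j i
  diagonal-sym i j with i ≟ j | j ≟ i
  ... | yes refl | yes _    = refl
  ... | yes refl | no i≢i   = ⊥-elim (i≢i refl)
  ... | no i≢j   | yes j≡i  = ⊥-elim (i≢j (sym j≡i))
  ... | no _     | no _     = refl

  P'-nonNeg : ∀ i j → 0ℚ ≤ P' G i j
  P'-nonNeg i j = subst (0ℚ ≤_) (sym (P'-split i j)) (+-nonNeg adjacency (diagonal-nonNeg i j))
    where
    adjacency : 0ℚ ≤ (if adj i j then δ else 0ℚ)
    adjacency with adj i j
    ... | true  = QP.<⇒≤ 0<δ
    ... | false = QP.≤-refl

  δ≤P'-edge : ∀ i j → adj i j ≡ true → δ ≤ P' G i j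
  δ≤P'-edge i j i~j = QP.≤-reflexive (sym (P'-edge i~j))

  δ≤P'-diag : ∀ i → δ ≤ P' G i i
  δ≤P'-diag i = subst (δ ≤_) (sym (P'-diag i)) (δ≤1-degℚ*δ i)

  P'-rowSum : ∀ i → sumℚ n (P' G i) ≡ 1ℚ
  P'-rowSum i = begin-equality
    sumℚ n (P' G i)                                                      ≡⟨ sumℚ-cong n (P'-split i) ⟩
    sumℚ n (λ j → (if adj i j then δ else 0ℚ) + diagonal i j)            ≡⟨ sumℚ-+ n _ (diagonal i) ⟩
    sumℚ n (λ j → if adj i j then δ else 0ℚ) + sumℚ n (diagonal i)       ≡⟨ cong₂ _+_ (sumℚ-count n (adj i) δ) (sumℚ-kronecker n i (1ℚ - degℚ i * δ)) ⟩
    ℕ→ℚ (deg G i) * δ + (1ℚ - degℚ i * δ)                                   ≡⟨ cong (λ z → z * δ + (1ℚ - degℚ i * δ)) (degℚ≡ i) ⟨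
    degℚ i * δ + (1ℚ - degℚ i * δ)                                             ≡⟨ solve 1 (λ x → x :+ (con 1ℚ :- x) := con 1ℚ) refl (degℚ i * δ) ⟩
    1ℚ                                                                   ∎

  P'-sym : ∀ i j → P' G i j ≡ P' G j i
  P'-sym i j = begin-equality
    P' G i j                                ≡⟨ P'≡ i j ⟩
    (if adj i j then δ else diagonal i j)   ≡⟨ cong₂ (if_then δ else_) (symmetric i j) (diagonal-sym i j) ⟩
    (if adj j i then δ else diagonal j i)   ≡⟨ P'≡ j i ⟨
    P' G j i                                ∎

  P'-colSum : ∀ j → sumℚ n (λ i → P' G i j) ≡ 1ℚ
  P'-colSum j = trans (sumℚ-cong n (λ i → P'-sym i j)) (P'-rowSum j)

  1≤Δ : 2 N.≤ n → Connected G → 1 N.≤ Δ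
  1≤Δ (N.s≤s (N.s≤s _)) connected with connected zero (suc zero)
  ... | there {w = w} 0~w _ = NP.≤-trans (count-pos n (adj zero) w 0~w) (deg≤Δ zero)

module HittingTimeEstimate {n : ℕ} (G : SimpleGraph n) (D : RotorWalk G) (v : Fin n)
                           {h : Fin n → ℚ} (hitting : IsHittingTime G v h) where

  open SimpleGraph G
  open ℕ→ℚ-Properties
  open RationalFacts
  open FiniteSums
  open SymmetricWalk G
  open StochasticMatrix (P' G) P'-nonNeg P'-rowSum
  open DoublyStochastic P'-colSum
  open HittingTime (proj₂ hitting)
  open Q using (_≤_)
  open QP.≤-Reasoning

  N κ : ℚ
  N = ℕ→ℚ n
  κ = ℕ→ℚ (κ̃ D)

  g : ℕ → Fin n → ℚ
  g = occupation v

  Pcol≡iterate : ∀ t i → Pcol G v t i ≡ iterate t (indicator v) i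
  Pcol≡iterate zero    i = refl
  Pcol≡iterate (suc t) i = apply-cong (Pcol≡iterate t) i

  edgeDifference : (Fin n → ℚ) → Fin n → Fin n → ℚ
  edgeDifference f i j = if adj i j then ∣ f i - f j ∣ else 0ℚ

  edgeVariation : (Fin n → ℚ) → ℚ
  edgeVariation f = sumℚ n (λ i → sumℚ n (edgeDifference f i))

  edgeDifference-nonNeg : ∀ f i j → 0ℚ ≤ edgeDifference f i j
  edgeDifference-nonNeg f i j with adj i j
  ... | true  = QP.0≤∣p∣ (f i - f j)
  ... | false = QP.≤-refl

  edgeVariation-nonNeg : ∀ f → 0ℚ ≤ edgeVariation f
  edgeVariation-nonNeg f = sumℚ-nonNeg n (λ i → sumℚ-nonNeg n (edgeDifference-nonNeg f i))

  ΨPartial-nonNeg : ∀ T → 0ℚ ≤ ΨPartial G v T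
  ΨPartial-nonNeg zero    = QP.≤-refl
  ΨPartial-nonNeg (suc T) = +-nonNeg (ΨPartial-nonNeg T) (*-nonNeg 0≤½ (edgeVariation-nonNeg (Pcol G v T)))

  edgeVariation-cong : ∀ {f f′} → (∀ i → f i ≡ f′ i) → edgeVariation f ≡ edgeVariation f′
  edgeVariation-cong f≡f′ = sumℚ-cong n (λ i → sumℚ-cong n (λ j →
    cong (if adj i j then_else 0ℚ) (cong₂ (λ x y → ∣ x - y ∣) (f≡f′ i) (f≡f′ j))))

  edgeVariation-+ : ∀ f f′ → edgeVariation (λ i → f i + f′ i) ≤ edgeVariation f + edgeVariation f′
  edgeVariation-+ f f′ = begin
    edgeVariation (λ i → f i + f′ i)
      ≤⟨ sumℚ-mono-≤ n (λ i → sumℚ-mono-≤ n (pointwise i)) ⟩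
    sumℚ n (λ i → sumℚ n (λ j → edgeDifference f i j + edgeDifference f′ i j))
      ≡⟨ sumℚ-cong n (λ i → sumℚ-+ n (edgeDifference f i) (edgeDifference f′ i)) ⟩
    sumℚ n (λ i → sumℚ n (edgeDifference f i) + sumℚ n (edgeDifference f′ i))
      ≡⟨ sumℚ-+ n _ _ ⟩
    edgeVariation f + edgeVariation f′
      ∎
    where
    pointwise : ∀ i j → edgeDifference (λ k → f k + f′ k) i j ≤ edgeDifference f i j + edgeDifference f′ i j
    pointwise i j with adj i j
    ... | true  = ∣[a+b]-[c+d]∣≤∣a-c∣+∣b-d∣ (f i) (f′ i) (f j) (f′ j)
    ... | false = QP.≤-refl

  edgeVariation-occupation : ∀ T → edgeVariation (g T) ≤ ΨPartial G v T + ΨPartial G v T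
  edgeVariation-occupation zero = QP.≤-reflexive (trans (sumℚ-cong n (λ i → trans (sumℚ-cong n zero-term) (sumℚ-zero n))) (sumℚ-zero n))
    where
    zero-term : ∀ {i} j → edgeDifference (λ _ → 0ℚ) i j ≡ 0ℚ
    zero-term {i} j with adj i j
    ... | true  = refl
    ... | false = refl
  edgeVariation-occupation (suc T) = begin
    edgeVariation (g (suc T))                         ≤⟨ edgeVariation-+ (g T) (iterate T (indicator v)) ⟩
    edgeVariation (g T) + edgeVariation (iterate T (indicator v))
                                                      ≡⟨ cong (λ z → edgeVariation (g T) + z) (edgeVariation-cong (λ i → sym (Pcol≡iterate T i))) ⟩
    edgeVariation (g T) + edgeVariation (Pcol G v T)  ≤⟨ QP.+-monoˡ-≤ _ (edgeVariation-occupation T) ⟩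
    Ψ + Ψ + edgeVariation (Pcol G v T)                ≡⟨ solve 2 (λ p a → p :+ p :+ a := (p :+ con ½ :* a) :+ (p :+ con ½ :* a)) refl Ψ (edgeVariation (Pcol G v T)) ⟩
    ΨPartial G v (suc T) + ΨPartial G v (suc T)       ∎
    where
    Ψ : ℚ
    Ψ = ΨPartial G v T

  L : Fin n → ℚ
  L i = ℕ→ℚ (len' D i)

  L≡[1+Δ]*mult : ∀ i → L i ≡ ℕ→ℚ (suc Δ) * ℕ→ℚ (RotorWalk.mult D i)
  L≡[1+Δ]*mult i = ℕ→ℚ-* (suc Δ) (RotorWalk.mult D i)

  mult≤κ : ∀ i → ℕ→ℚ (RotorWalk.mult D i) ≤ κ
  mult≤κ = ℕ→ℚ-mono-≤ ∘ f≤maxℕ n (RotorWalk.mult D)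

  L*δ≤κ : ∀ i → L i * δ ≤ κ
  L*δ≤κ i = subst (_≤ κ) (sym L*δ≡mult) (mult≤κ i)
    where
    m : ℚ
    m = ℕ→ℚ (RotorWalk.mult D i)
    L*δ≡mult : L i * δ ≡ m
    L*δ≡mult = begin-equality
      L i * δ                     ≡⟨ cong (_* δ) (L≡[1+Δ]*mult i) ⟩
      ℕ→ℚ (suc Δ) * m * δ         ≡⟨ solve 3 (λ a m e → a :* m :* e := e :* a :* m) refl (ℕ→ℚ (suc Δ)) m δ ⟩
      δ * ℕ→ℚ (suc Δ) * m         ≡⟨ cong (_* m) δ*[1+Δ]≡1 ⟩
      1ℚ * m                      ≡⟨ QP.*-identityˡ m ⟩
      m                           ∎

  L≤[1+Δ]κ : ∀ i → L i ≤ ℕ→ℚ (suc Δ) * κ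
  L≤[1+Δ]κ i = subst (_≤ ℕ→ℚ (suc Δ) * κ) (sym (L≡[1+Δ]*mult i)) (*-monoˡ-≤ (ℕ→ℚ-nonNeg (suc Δ)) (mult≤κ i))

  module Pairs (T : ℕ) {W : ℚ} (h-close : ∀ i j → ∣ h i - h j ∣ ≤ N * ∣ g T i - g T j ∣ + W) where

    Ψ : ℚ
    Ψ = ΨPartial G v T

    adjacent diagonalBound : Fin n → Fin n → ℚ
    adjacent i j      = if adj i j then 1ℚ else 0ℚ
    diagonalBound i j = if ⌊ i ≟ j ⌋ then ℕ→ℚ (suc Δ) * κ else 0ℚ

    bound : Fin n → Fin n → ℚ
    bound i j = κ * N * edgeDifference (g T) i j + κ * (W + 1ℚ) * adjacent i j + diagonalBound i j

    bound-≡ : ∀ {i j x y z} → edgeDifference (g T) i j ≡ x → adjacent i j ≡ y → diagonalBound i j ≡ z →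
              bound i j ≡ κ * N * x + κ * (W + 1ℚ) * y + z
    bound-≡ ≡x ≡y ≡z = cong₂ _+_ (cong₂ _+_ (cong (κ * N *_) ≡x) (cong (κ * (W + 1ℚ) *_) ≡y)) ≡z

    edge-bound : ∀ {i j} → adj i j ≡ true → L i * P' G i j * ∣ h i - h j - 1ℚ ∣ ≤ bound i j
    edge-bound {i} {j} i~j = begin
      L i * P' G i j * A                      ≡⟨ cong (λ p → L i * p * A) (P'-edge i~j) ⟩
      L i * δ * A                             ≤⟨ *-monoʳ-≤ (QP.0≤∣p∣ _) (L*δ≤κ i) ⟩
      κ * A                                   ≤⟨ *-monoˡ-≤ (ℕ→ℚ-nonNeg (κ̃ D)) A≤ ⟩
      κ * (N * ∣ g T i - g T j ∣ + W + 1ℚ)    ≡⟨ solve 4 (λ k m x w → k :* (m :* x :+ w :+ con 1ℚ) := k :* m :* x :+ k :* (w :+ con 1ℚ) :* con 1ℚ :+ con 0ℚ) refl κ N ∣ g T i - g T j ∣ W ⟩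
      κ * N * ∣ g T i - g T j ∣ + κ * (W + 1ℚ) * 1ℚ + 0ℚ
                                              ≡⟨ bound-≡ (cong (if_then ∣ g T i - g T j ∣ else 0ℚ) i~j) (cong (if_then 1ℚ else 0ℚ) i~j) (kronecker-≢ (adj⇒≢ i~j)) ⟨
      bound i j                               ∎
      where
      A : ℚ
      A = ∣ h i - h j - 1ℚ ∣
      A≤ : A ≤ N * ∣ g T i - g T j ∣ + W + 1ℚ
      A≤ = QP.≤-trans (QP.∣p-q∣≤∣p∣+∣q∣ (h i - h j) 1ℚ) (QP.+-monoˡ-≤ 1ℚ (h-close i j))

    diagonal-bound : ∀ i → L i * P' G i i * ∣ h i - h i - 1ℚ ∣ ≤ bound i i
    diagonal-bound i = begin
      L i * P' G i i * ∣ h i - h i - 1ℚ ∣      ≡⟨ cong₂ (λ p x → L i * p * ∣ x ∣) (P'-diag i) (solve 1 (λ x → x :- x :- con 1ℚ := :- con 1ℚ) refl (h i)) ⟩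
      L i * (1ℚ - degℚ i * δ) * 1ℚ                 ≡⟨ solve 3 (λ l x e → l :* (con 1ℚ :- x :* e) :* con 1ℚ := l :- l :* (x :* e)) refl (L i) (degℚ i) δ ⟩
      L i - L i * (degℚ i * δ)                     ≤⟨ ≤-fromDifference (L i * (degℚ i * δ)) (solve 2 (λ l y → l :- (l :- y) := y) refl (L i) (L i * (degℚ i * δ)))
                                                     (*-nonNeg (ℕ→ℚ-nonNeg (len' D i)) (*-nonNeg (degℚ-nonNeg i) (QP.<⇒≤ 0<δ))) ⟩
      L i                                       ≤⟨ L≤[1+Δ]κ i ⟩
      ℕ→ℚ (suc Δ) * κ                           ≡⟨ solve 4 (λ k m w c → c := k :* m :* con 0ℚ :+ k :* (w :+ con 1ℚ) :* con 0ℚ :+ c) refl κ N W (ℕ→ℚ (suc Δ) * κ) ⟩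
      κ * N * 0ℚ + κ * (W + 1ℚ) * 0ℚ + ℕ→ℚ (suc Δ) * κ
                                                ≡⟨ bound-≡ (cong (if_then ∣ g T i - g T i ∣ else 0ℚ) (loopless i)) (cong (if_then 1ℚ else 0ℚ) (loopless i)) (kronecker-≡ i) ⟨
      bound i i                                 ∎

    off-bound : ∀ {i j} → adj i j ≡ false → ¬ i ≡ j → L i * P' G i j * ∣ h i - h j - 1ℚ ∣ ≤ bound i j
    off-bound {i} {j} i≁j i≢j = QP.≤-reflexive (begin-equality
      L i * P' G i j * A                    ≡⟨ cong (λ p → L i * p * A) (P'-off i≁j i≢j) ⟩
      L i * 0ℚ * A                          ≡⟨ solve 5 (λ l a k m w → l :* con 0ℚ :* a := k :* m :* con 0ℚ :+ k :* (w :+ con 1ℚ) :* con 0ℚ :+ con 0ℚ) refl (L i) A κ N W ⟩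
      κ * N * 0ℚ + κ * (W + 1ℚ) * 0ℚ + 0ℚ   ≡⟨ bound-≡ (cong (if_then ∣ g T i - g T j ∣ else 0ℚ) i≁j) (cong (if_then 1ℚ else 0ℚ) i≁j) (kronecker-≢ i≢j) ⟨
      bound i j                             ∎)
      where
      A : ℚ
      A = ∣ h i - h j - 1ℚ ∣

    -- Matching on arguments instead of `with` avoids normalising the goal.
    pair-bound : ∀ i j → L i * P' G i j * ∣ h i - h j - 1ℚ ∣ ≤ bound i j
    pair-bound i j = by-cases i j (adj i j) refl (i ≟ j)
      where
      by-cases : ∀ i j b → adj i j ≡ b → Dec (i ≡ j) → L i * P' G i j * ∣ h i - h j - 1ℚ ∣ ≤ bound i j
      by-cases i j true  i~j _          = edge-bound i~j
      by-cases i i false _   (yes refl) = diagonal-bound i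
      by-cases i j false i≁j (no i≢j)   = off-bound i≁j i≢j

    sum-pairs-bound : ∀ i → sumℚ n (bound i)
                            ≡ κ * N * sumℚ n (edgeDifference (g T) i) + κ * (W + 1ℚ) * (ℕ→ℚ (deg G i) * 1ℚ) + ℕ→ℚ (suc Δ) * κ
    sum-pairs-bound i = trans (sumℚ-linear n (κ * N) (κ * (W + 1ℚ)) (edgeDifference (g T) i) (adjacent i) (diagonalBound i))
      (cong₂ (λ a b → κ * N * sumℚ n (edgeDifference (g T) i) + κ * (W + 1ℚ) * a + b)
             (sumℚ-count n (adj i) 1ℚ) (sumℚ-kronecker n i (ℕ→ℚ (suc Δ) * κ)))

    sum-pairs≤ : 0ℚ ≤ W → sumℚ n (λ i → sumℚ n (λ j → L i * P' G i j * ∣ h i - h j - 1ℚ ∣))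
                          ≤ κ * N * (Ψ + Ψ) + κ * (W + 1ℚ) * (N * ℕ→ℚ Δ) + N * (ℕ→ℚ (suc Δ) * κ)
    sum-pairs≤ 0≤W = begin
      sumℚ n (λ i → sumℚ n (λ j → L i * P' G i j * ∣ h i - h j - 1ℚ ∣))
        ≤⟨ sumℚ-mono-≤ n (λ i → sumℚ-mono-≤ n (pair-bound i)) ⟩
      sumℚ n (λ i → sumℚ n (bound i))
        ≡⟨ sumℚ-cong n sum-pairs-bound ⟩
      sumℚ n (λ i → κ * N * sumℚ n (edgeDifference (g T) i) + κ * (W + 1ℚ) * (ℕ→ℚ (deg G i) * 1ℚ) + ℕ→ℚ (suc Δ) * κ)
        ≡⟨ trans (sumℚ-linear n (κ * N) (κ * (W + 1ℚ)) _ _ _) (cong (λ z → κ * N * edgeVariation (g T) + κ * (W + 1ℚ) * sumℚ n (λ i → ℕ→ℚ (deg G i) * 1ℚ) + z) (sumℚ-const n _)) ⟩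
      κ * N * edgeVariation (g T) + κ * (W + 1ℚ) * sumℚ n (λ i → ℕ→ℚ (deg G i) * 1ℚ) + N * (ℕ→ℚ (suc Δ) * κ)
        ≤⟨ QP.+-monoˡ-≤ _ (QP.+-mono-≤ (*-monoˡ-≤ 0≤κN (edgeVariation-occupation T)) (*-monoˡ-≤ 0≤κ[W+1] sumℚ-deg≤NΔ)) ⟩
      κ * N * (Ψ + Ψ) + κ * (W + 1ℚ) * (N * ℕ→ℚ Δ) + N * (ℕ→ℚ (suc Δ) * κ)
        ∎
      where
      0≤κN : 0ℚ ≤ κ * N
      0≤κN = *-nonNeg (ℕ→ℚ-nonNeg (κ̃ D)) (ℕ→ℚ-nonNeg n)
      0≤κ[W+1] : 0ℚ ≤ κ * (W + 1ℚ)
      0≤κ[W+1] = *-nonNeg (ℕ→ℚ-nonNeg (κ̃ D)) (+-nonNeg 0≤W 0≤1)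
      sumℚ-deg≤NΔ : sumℚ n (λ i → ℕ→ℚ (deg G i) * 1ℚ) ≤ N * ℕ→ℚ Δ
      sumℚ-deg≤NΔ = subst (sumℚ n (λ i → ℕ→ℚ (deg G i) * 1ℚ) ≤_) (sumℚ-const n (ℕ→ℚ Δ))
        (sumℚ-mono-≤ n (λ i → subst (_≤ ℕ→ℚ Δ) (sym (QP.*-identityʳ (ℕ→ℚ (deg G i)))) (ℕ→ℚ-mono-≤ (deg≤Δ i))))

    K'-terms≤ : ∀ {ε} → 0ℚ ≤ W → 1 N.≤ Δ → κ * N * ℕ→ℚ Δ * W ≤ ε →
                maxℚ n h + ½ * ((1ℚ + ℕ→ℚ Δ) * κ * N + (κ * N * (Ψ + Ψ) + κ * (W + 1ℚ) * (N * ℕ→ℚ Δ) + N * ((1ℚ + ℕ→ℚ Δ) * κ)))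
                ≤ ℕ→ℚ 3 * (maxℚ n h + κ * N * Ψ + N * ℕ→ℚ Δ * κ) + ε
    K'-terms≤ {ε} 0≤W 1≤Δ κNΔW≤ε = ≤-fromDifference slack slack≡ 0≤slack
      where
      mh Δ′ : ℚ
      mh = maxℚ n h
      Δ′ = ℕ→ℚ Δ
      slack : ℚ
      slack = (1ℚ + 1ℚ) * mh + (1ℚ + 1ℚ) * (κ * N * Ψ) + κ * N * (Δ′ - 1ℚ) + ½ * (κ * N * Δ′)
              + (ε - κ * N * Δ′ * W) + ½ * (κ * N * Δ′ * W)
      slack≡ : ℕ→ℚ 3 * (mh + κ * N * Ψ + N * Δ′ * κ) + ε
               - (mh + ½ * ((1ℚ + Δ′) * κ * N + (κ * N * (Ψ + Ψ) + κ * (W + 1ℚ) * (N * Δ′) + N * ((1ℚ + Δ′) * κ))))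
               ≡ slack
      slack≡ = solve 7 (λ M K NN S DD WW E →
          con (ℕ→ℚ 3) :* (M :+ K :* NN :* S :+ NN :* DD :* K) :+ E
          :- (M :+ con ½ :* ((con 1ℚ :+ DD) :* K :* NN :+ (K :* NN :* (S :+ S) :+ K :* (WW :+ con 1ℚ) :* (NN :* DD) :+ NN :* ((con 1ℚ :+ DD) :* K))))
        := (con 1ℚ :+ con 1ℚ) :* M :+ (con 1ℚ :+ con 1ℚ) :* (K :* NN :* S) :+ K :* NN :* (DD :- con 1ℚ) :+ con ½ :* (K :* NN :* DD)
           :+ (E :- K :* NN :* DD :* WW) :+ con ½ :* (K :* NN :* DD :* WW))
        refl mh κ N Ψ Δ′ W ε
      0≤κN : 0ℚ ≤ κ * N
      0≤κN = *-nonNeg (ℕ→ℚ-nonNeg (κ̃ D)) (ℕ→ℚ-nonNeg n)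
      0≤2 : 0ℚ ≤ 1ℚ + 1ℚ
      0≤2 = +-nonNeg 0≤1 0≤1
      0≤mh : 0ℚ ≤ mh
      0≤mh = subst (_≤ mh) (proj₁ hitting) (f≤maxℚ n h v)
      0≤slack : 0ℚ ≤ slack
      0≤slack = +-nonNeg (+-nonNeg (+-nonNeg (+-nonNeg (+-nonNeg
        (*-nonNeg 0≤2 0≤mh)
        (*-nonNeg 0≤2 (*-nonNeg 0≤κN (ΨPartial-nonNeg T))))
        (*-nonNeg 0≤κN (p≤q⇒0≤q-p (ℕ→ℚ-mono-≤ 1≤Δ))))
        (*-nonNeg 0≤½ (*-nonNeg 0≤κN (ℕ→ℚ-nonNeg Δ))))
        (p≤q⇒0≤q-p κNΔW≤ε))
        (*-nonNeg 0≤½ (*-nonNeg (*-nonNeg 0≤κN (ℕ→ℚ-nonNeg Δ)) 0≤W))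

    K'≤ : ∀ {ε} → 0ℚ ≤ W → 1 N.≤ Δ → κ * N * ℕ→ℚ Δ * W ≤ ε →
          K' G D v h ≤ ℕ→ℚ 3 * (maxℚ n h + κ * N * Ψ + ℕ→ℚ (n N.* Δ N.* κ̃ D)) + ε
    K'≤ {ε} 0≤W 1≤Δ κNΔW≤ε = begin
      maxℚ n h + ½ * (L v * N + sumℚ n (λ i → sumℚ n (λ j → L i * P' G i j * ∣ h i - h j - 1ℚ ∣)))
        ≤⟨ QP.+-monoʳ-≤ (maxℚ n h) (*-monoˡ-≤ 0≤½ (QP.+-mono-≤ (*-monoʳ-≤ (ℕ→ℚ-nonNeg n) (L≤[1+Δ]κ v)) (sum-pairs≤ 0≤W))) ⟩
      maxℚ n h + ½ * (ℕ→ℚ (suc Δ) * κ * N + (κ * N * (Ψ + Ψ) + κ * (W + 1ℚ) * (N * ℕ→ℚ Δ) + N * (ℕ→ℚ (suc Δ) * κ)))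
        ≡⟨ cong (λ a → maxℚ n h + ½ * (a * κ * N + (κ * N * (Ψ + Ψ) + κ * (W + 1ℚ) * (N * ℕ→ℚ Δ) + N * (a * κ)))) (ℕ→ℚ-suc Δ) ⟩
      maxℚ n h + ½ * ((1ℚ + ℕ→ℚ Δ) * κ * N + (κ * N * (Ψ + Ψ) + κ * (W + 1ℚ) * (N * ℕ→ℚ Δ) + N * ((1ℚ + ℕ→ℚ Δ) * κ)))
        ≤⟨ K'-terms≤ 0≤W 1≤Δ κNΔW≤ε ⟩
      ℕ→ℚ 3 * (maxℚ n h + κ * N * Ψ + N * ℕ→ℚ Δ * κ) + ε
        ≡⟨ cong (λ z → ℕ→ℚ 3 * (maxℚ n h + κ * N * Ψ + z) + ε) (sym (trans (ℕ→ℚ-* (n N.* Δ) (κ̃ D)) (cong (_* κ) (ℕ→ℚ-* n Δ)))) ⟩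
      ℕ→ℚ 3 * (maxℚ n h + κ * N * Ψ + ℕ→ℚ (n N.* Δ N.* κ̃ D)) + ε
        ∎

  h-close : ∀ {T a W} → Within (iterate T h) a W → ∀ i j → ∣ h i - h j ∣ ≤ N * ∣ g T i - g T j ∣ + W
  h-close {T} {a} {W} (a≤hᵀ , hᵀ≤a+W) i j = begin
    ∣ h i - h j ∣                                         ≡⟨ cong ∣_∣ h-difference ⟩
    ∣ (hᵀ i - hᵀ j) - N * (g T i - g T j) ∣               ≤⟨ QP.∣p-q∣≤∣p∣+∣q∣ (hᵀ i - hᵀ j) (N * (g T i - g T j)) ⟩
    ∣ hᵀ i - hᵀ j ∣ + ∣ N * (g T i - g T j) ∣             ≡⟨ cong (∣ hᵀ i - hᵀ j ∣ +_) (trans (QP.∣p*q∣≡∣p∣*∣q∣ N _) (cong (_* ∣ g T i - g T j ∣) (QP.0≤p⇒∣p∣≡p (ℕ→ℚ-nonNeg n)))) ⟩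
    ∣ hᵀ i - hᵀ j ∣ + N * ∣ g T i - g T j ∣               ≤⟨ QP.+-monoˡ-≤ _ (∣p-q∣≤w a W (a≤hᵀ i) (hᵀ≤a+W i) (a≤hᵀ j) (hᵀ≤a+W j)) ⟩
    W + N * ∣ g T i - g T j ∣                             ≡⟨ QP.+-comm W _ ⟩
    N * ∣ g T i - g T j ∣ + W                             ∎
    where
    hᵀ : Fin n → ℚ
    hᵀ = iterate T h
    h≡ : ∀ k → h k ≡ hᵀ k + ℕ→ℚ T - N * g T k
    h≡ k = trans (solve 3 (λ y m x → y := y :+ m :* x :- m :* x) refl (h k) N (g T k))
                 (cong (_- N * g T k) (h+n*occupation≡iterate+T T k))
    h-difference : h i - h j ≡ (hᵀ i - hᵀ j) - N * (g T i - g T j)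
    h-difference = trans (cong₂ _-_ (h≡ i) (h≡ j))
      (solve 6 (λ a b t m x y → a :+ t :- m :* x :- (b :+ t :- m :* y) := (a :- b) :- m :* (x :- y))
             refl (hᵀ i) (hᵀ j) (ℕ→ℚ T) N (g T i) (g T j))

  module _ (connected : Connected G) where

    private
      K : ℕ
      K = maxℕ n (λ i → reach-length (connected i v))
      η : ℚ
      η = δ ^ K
      η≤1 : η ≤ 1ℚ
      η≤1 = ^-≤1 K (QP.<⇒≤ 0<δ) δ≤1
      η≤Pᴷ : ∀ i → η ≤ iterate K (indicator v) i
      η≤Pᴷ i = δ^m≤iterate-indicator G (QP.<⇒≤ 0<δ) δ≤P'-edge (δ≤P'-diag v) (connected i v) K
                 (f≤maxℕ n (λ i → reach-length (connected i v)) i)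
      M : ℚ
      M = maxℚ n (λ i → ∣ h i ∣)
      ∣h∣≤M : ∀ i → ∣ h i ∣ ≤ M
      ∣h∣≤M = f≤maxℚ n (λ i → ∣ h i ∣)
      h∈[-M,M] : Within h (- M) (M + M)
      h∈[-M,M] = (λ i → QP.≤-trans (QP.neg-antimono-≤ (∣h∣≤M i)) (-∣p∣≤p (h i)))
               , (λ i → QP.≤-trans (p≤∣p∣ (h i)) (subst (∣ h i ∣ ≤_) (solve 1 (λ m → m := :- m :+ (m :+ m)) refl M) (∣h∣≤M i)))

    iterate-concentrates : ∀ B {ε} → 0ℚ < ε →
             Σ ℕ λ T → Σ ℚ λ W → 0ℚ ≤ W × B * W ≤ ε × Σ ℚ λ a → Within (iterate T h) a W
    iterate-concentrates B {ε} 0<ε = k N.* K , W , 0≤W , B*W≤ε , contraction-iterate k h∈[-M,M]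
      where
      open Doeblin {v} {K} {η} η≤Pᴷ
      decay : Σ ℕ λ k → (1ℚ - η) ^ k * (B * (M + M)) ≤ ε
      decay = geometric-decay (B * (M + M)) 0<ε (^-pos K 0<δ) η≤1
      k : ℕ
      k = proj₁ decay
      W : ℚ
      W = (1ℚ - η) ^ k * (M + M)
      0≤M : 0ℚ ≤ M
      0≤M = QP.≤-trans (QP.0≤∣p∣ (h v)) (∣h∣≤M v)
      0≤W : 0ℚ ≤ W
      0≤W = *-nonNeg (^-nonNeg k (p≤q⇒0≤q-p η≤1)) (+-nonNeg 0≤M 0≤M)
      B*W≤ε : B * W ≤ ε
      B*W≤ε = subst (_≤ _) (solve 3 (λ q b m → q :* (b :* m) := b :* (q :* m)) refl ((1ℚ - η) ^ k) B (M + M)) (proj₂ decay)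

open import Data.Nat using (_≤_)

theorem3p8 : Σ ℚ λ C → (0ℚ < C) ×
  ((n : ℕ) → 2 ≤ n → (G : SimpleGraph n) → Connected G →
   (D : RotorWalk G) → (v : Fin n) →
   (h : Fin n → ℚ) → IsHittingTime G v h →
   (ε : ℚ) → 0ℚ < ε →
   Σ ℕ λ T →
     K' G D v h Q.≤
       C * (maxℚ n h
            + ℕ→ℚ (κ̃ D) * ℕ→ℚ n * ΨPartial G v T
            + ℕ→ℚ (n N.* maxDeg G N.* κ̃ D))
       + ε)
theorem3p8 = ℕ→ℚ 3 , QP.positive⁻¹ (ℕ→ℚ 3) , λ n 2≤n G connected D v h hitting ε 0<ε →
  let open HittingTimeEstimate G D v hitting
      T , W , 0≤W , κNΔW≤ε , _ , hᵀ∈[a,a+W] = iterate-concentrates connected (κ * N * ℕ→ℚ (maxDeg G)) 0<ε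
  in  T , Pairs.K'≤ T (h-close {T} hᵀ∈[a,a+W]) 0≤W (SymmetricWalk.1≤Δ G 2≤n connected) κNΔW≤ε
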